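{- For every set system $D=(E,\mathcal{F})$ and every pair of distinct elements $a,b\in E$, $$\partial_{\omega_{D}}(z)+\partial_{\omega_{\widetilde{D'}_{ab}}}(z)-\partial_{\omega_{D'_{ab}}}(z)-\partial_{\omega_{\widetilde{D}_{ab}}}(z)=0,$$ i.e. the twist polynomial of set systems satisfies the four-term relation.
   Context: A set system $D=(E,\mathcal{F})$ is a finite set $E$ together with a nonempty collection $\mathcal{F}\subseteq 2^E$ of feasible sets. $\triangle$ denotes symmetric difference. For $A\subseteq E$, the twist $D*A$ is $(E,\{A\triangle X: X\in\mathcal{F}\})$. The width $\omega(D)$ is the size of a largest feasible set minus the size of a smallest feasible set. The twist polynomial is $\partial_{\omega_D}(z)=\sum_{A\subseteq E} z^{\omega(D*A)}$. For distinct $a,b\in E$: the handle sliding of $a$ over $b$ is $\widetilde{D}_{ab}=(E,\mathcal{F}\triangle\{F\cup\{a\}: F\cup\{b\}\in\mathcal{F},\ F\subseteq E\setminus\{a,b\}\})$; the exchange of handle ends of $a$ and $b$ is $D'_{ab}=(E,\mathcal{F}\triangle\{F\cup\{a,b\}: F\in\mathcal{F},\ F\subseteq E\setminus\{a,b\}\})$; and $\widetilde{D'}_{ab}=\widetilde{(D'_{ab})}_{ab}$ is the result of first exchanging handle ends of $a$ and $b$ and then handle sliding $a$ over $b$ (applied to $D'_{ab}$). -}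

module Defs where

open import Data.Nat using (ℕ; zero; suc; _∸_; _⊔_; _⊓_)
open import Data.Bool using (Bool; true; false; _xor_; _∧_; not; if_then_else_)
open import Data.Fin using (Fin)
open import Data.Fin.Subset using (Subset; ∣_∣)
open import Data.Vec using (Vec; []; _∷_; lookup; zipWith; _[_]≔_)
open import Data.List using (List; []; _∷_; map; filter; foldr; _++_; length)
open import Data.Product using (∃)
open import Relation.Binary.PropositionalEquality using (_≡_)
open import Relation.Nullary.Decidable using (Dec)
open import Data.Bool.Properties using (_≟_)

-- The ground set E is Fin n; a subset of E is a Subset n (= Vec Bool n).
-- A set system on E is given by the characteristic function of its
-- collection of feasible sets.
Family : ℕ → Set
Family n = Subset n → Bool

record SetSystem (n : ℕ) : Set where
  constructor setSystem
  field
    feasible : Family n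
    nonempty : ∃ λ X → feasible X ≡ true
open SetSystem public

allSubsets : (n : ℕ) → List (Subset n)
allSubsets zero = [] ∷ []
allSubsets (suc n) = map (false ∷_) (allSubsets n) ++ map (true ∷_) (allSubsets n)

_△_ : ∀ {n} → Subset n → Subset n → Subset n
A △ B = zipWith _xor_ A B

-- width of a family: largest feasible size minus smallest feasible size
-- (for the empty family this is 0; never used on empty families)
width : ∀ {n} → Family n → ℕ
width {n} F = foldr _⊔_ 0 sizes ∸ foldr _⊓_ n sizes
  where
  sizes : List ℕ
  sizes = map ∣_∣ (filter (λ X → F X ≟ true) (allSubsets n))

twistF : ∀ {n} → Family n → Subset n → Family n
twistF F A Y = F (A △ Y)

twistPolyCoeff : ∀ {n} → Family n → ℕ → ℕ
twistPolyCoeff {n} F k =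
  length (filter (λ A → width (twistF F A) Data.Nat.≟ k) (allSubsets n))

-- handle sliding of a over b:
-- F △ { X ∪ {a} : X ∪ {b} ∈ F, X ⊆ E ∖ {a,b} }
-- Y is in the added collection iff a ∈ Y, b ∉ Y and (Y ∖ {a}) ∪ {b} ∈ F.
handleSlideF : ∀ {n} → Fin n → Fin n → Family n → Family n
handleSlideF a b F Y =
  F Y xor (lookup Y a ∧ not (lookup Y b) ∧ F ((Y [ a ]≔ false) [ b ]≔ true))

-- exchange of handle ends of a and b:
-- F △ { X ∪ {a,b} : X ∈ F, X ⊆ E ∖ {a,b} }
exchangeF : ∀ {n} → Fin n → Fin n → Family n → Family n
exchangeF a b F Y =
  F Y xor (lookup Y a ∧ lookup Y b ∧ F ((Y [ a ]≔ false) [ b ]≔ false))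

-- Split the twists D * A according to whether A meets {a, b} in zero or two elements,
-- or in exactly one.  In the first case handle sliding of a over b does not change the
-- width of the twist: the set it toggles in, X ∪ {a}, is the image of the feasible set
-- X ∪ {b} under the transposition of a and b, so after twisting by A both have the same
-- size.  In the second case the exchange of handle ends does not change the width, for
-- the same reason with X ∪ {a, b} and X.  As handle sliding and exchange commute, every
-- A contributes the same pair of widths to the positive and to the negative side of the
-- four-term relation.
module Submission where

open import Algebra.Bundles using (CommutativeRing)
import Algebra.Properties.CommutativeSemigroup
open import Data.Bool using (Bool; true; false; not; _∧_; _xor_; if_then_else_)
open import Data.Bool.Properties
  using (xor-assoc; xor-same; xor-identityʳ; ¬-not; not-injective; xor-∧-commutativeRing)
  renaming (_≟_ to _≟ᵇ_)
open import Data.Fin using (Fin; zero; suc)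
open import Data.Fin.Subset using (Subset; ∣_∣)
open import Data.Integer using (+_; _+_; _-_)
open import Data.Integer.Tactic.RingSolver using (solve-∀)
open import Data.List using (List; []; _∷_; map; filter; foldr; length)
open import Data.List.Membership.Propositional using (_∈_)
open import Data.List.Membership.Propositional.Properties
  using (∈-map⁺; ∈-map⁻; ∈-filter⁺; ∈-filter⁻; ∈-++⁺ˡ; ∈-++⁺ʳ)
open import Data.List.Relation.Binary.Subset.Propositional using (_⊆_)
open import Data.List.Relation.Unary.Any using (here; there)
open import Data.Nat as ℕ using (ℕ; suc; _≤_; _∸_; _⊔_; _⊓_; _≟_)
open import Data.Nat.Properties
  using (≤-refl; ≤-trans; ≤-antisym; m≤m⊔n; m≤n⊔m; ⊔-lub; m⊓n≤m; m⊓n≤n; ⊓-glb;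
         +-comm; +-commutativeSemigroup; suc-injective)
open import Data.Product using (∃; _×_; _,_)
open import Data.Sum using (_⊎_; inj₁; inj₂)
open import Data.Vec using ([]; _∷_; lookup; _[_]≔_)
open import Data.Vec.Properties using (lookup∘update; lookup∘update′; lookup-zipWith)
open import Function using (_∘_)
open import Function.Bundles using (_⇔_; mk⇔; Equivalence)
import Function.Properties.Equivalence as ⇔
open import Relation.Binary.PropositionalEquality
  using (_≡_; _≢_; _≗_; refl; sym; trans; cong; cong₂; subst; module ≡-Reasoning)
open import Relation.Nullary using (does; yes; no)

open import Algebra.Properties.CommutativeSemigroup +-commutativeSemigroup
  using (interchange)

open import Defs

open Equivalence using (to; from)

Attains : ∀ {n} → (Subset n → ℕ) → Family n → ℕ → Set
Attains w F s = ∃ λ X → F X ≡ true × w X ≡ s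

allSubsets-complete : ∀ {n} (X : Subset n) → X ∈ allSubsets n
allSubsets-complete [] = here refl
allSubsets-complete {suc n} (false ∷ X) =
  ∈-++⁺ˡ (∈-map⁺ (false ∷_) (allSubsets-complete X))
allSubsets-complete {suc n} (true ∷ X) =
  ∈-++⁺ʳ (map (false ∷_) (allSubsets n)) (∈-map⁺ (true ∷_) (allSubsets-complete X))

foldr-⊔-upper : ∀ {x} xs → x ∈ xs → x ≤ foldr _⊔_ 0 xs
foldr-⊔-upper (y ∷ ys) (here refl) = m≤m⊔n y _
foldr-⊔-upper (y ∷ ys) (there x∈ys) = ≤-trans (foldr-⊔-upper ys x∈ys) (m≤n⊔m y _)

foldr-⊔-mono : ∀ {xs ys} → xs ⊆ ys → foldr _⊔_ 0 xs ≤ foldr _⊔_ 0 ys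
foldr-⊔-mono {[]} xs⊆ys = ℕ.z≤n
foldr-⊔-mono {x ∷ xs} {ys} xs⊆ys =
  ⊔-lub (foldr-⊔-upper ys (xs⊆ys (here refl))) (foldr-⊔-mono (xs⊆ys ∘ there))

foldr-⊓-lower : ∀ {x} m xs → x ∈ xs → foldr _⊓_ m xs ≤ x
foldr-⊓-lower m (y ∷ ys) (here refl) = m⊓n≤m y _
foldr-⊓-lower m (y ∷ ys) (there x∈ys) = ≤-trans (m⊓n≤n y _) (foldr-⊓-lower m ys x∈ys)

foldr-⊓-≤-init : ∀ m xs → foldr _⊓_ m xs ≤ m
foldr-⊓-≤-init m [] = ≤-refl
foldr-⊓-≤-init m (y ∷ ys) = ≤-trans (m⊓n≤n y _) (foldr-⊓-≤-init m ys)

foldr-⊓-antimono : ∀ m {xs ys} → ys ⊆ xs → foldr _⊓_ m xs ≤ foldr _⊓_ m ys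
foldr-⊓-antimono m {xs} {[]} ys⊆xs = foldr-⊓-≤-init m xs
foldr-⊓-antimono m {xs} {y ∷ ys} ys⊆xs =
  ⊓-glb (foldr-⊓-lower m xs (ys⊆xs (here refl))) (foldr-⊓-antimono m (ys⊆xs ∘ there))

feasibleSizes : ∀ {n} → Family n → List ℕ
feasibleSizes {n} F = map ∣_∣ (filter (λ X → F X ≟ᵇ true) (allSubsets n))

∈-feasibleSizes⇔ : ∀ {n} (F : Family n) s → s ∈ feasibleSizes F ⇔ Attains ∣_∣ F s
∈-feasibleSizes⇔ F s = mk⇔ sound complete
  where
  sound : s ∈ feasibleSizes F → Attains ∣_∣ F s
  sound s∈ with ∈-map⁻ ∣_∣ s∈
  ... | X , X∈ , refl with ∈-filter⁻ (λ X → F X ≟ᵇ true) {xs = allSubsets _} X∈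
  ...   | _ , FX = X , FX , refl
  complete : Attains ∣_∣ F s → s ∈ feasibleSizes F
  complete (X , FX , refl) =
    ∈-map⁺ ∣_∣ (∈-filter⁺ (λ X → F X ≟ᵇ true) (allSubsets-complete X) FX)

width-cong : ∀ {n} {F G : Family n} →
  (∀ s → Attains ∣_∣ F s ⇔ Attains ∣_∣ G s) → width F ≡ width G
width-cong {n} {F} {G} F⇔G = cong₂ _∸_
  (≤-antisym (foldr-⊔-mono F⊆G) (foldr-⊔-mono G⊆F))
  (≤-antisym (foldr-⊓-antimono n G⊆F) (foldr-⊓-antimono n F⊆G))
  where
  F⊆G : feasibleSizes F ⊆ feasibleSizes G
  F⊆G {s} = from (∈-feasibleSizes⇔ G s) ∘ to (F⇔G s) ∘ to (∈-feasibleSizes⇔ F s)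
  G⊆F : feasibleSizes G ⊆ feasibleSizes F
  G⊆F {s} = from (∈-feasibleSizes⇔ F s) ∘ from (F⇔G s) ∘ to (∈-feasibleSizes⇔ G s)

width-≗ : ∀ {n} {F G : Family n} → F ≗ G → width F ≡ width G
width-≗ F≗G = width-cong λ s →
  mk⇔ (λ (X , FX , eq) → X , trans (sym (F≗G X)) FX , eq)
      (λ (X , GX , eq) → X , trans (F≗G X) GX , eq)

△-involutive : ∀ {n} (A Y : Subset n) → A △ (A △ Y) ≡ Y
△-involutive [] [] = refl
△-involutive (x ∷ A) (y ∷ Y) =
  cong₂ _∷_ (trans (sym (xor-assoc x x y)) (cong (_xor y) (xor-same x))) (△-involutive A Y)

attains-twistF⇔ : ∀ {n} (F : Family n) A s →
  Attains ∣_∣ (twistF F A) s ⇔ Attains (λ Z → ∣ A △ Z ∣) F s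
attains-twistF⇔ F A s = mk⇔
  (λ (Y , FAY , eq) → A △ Y , FAY , trans (cong ∣_∣ (△-involutive A Y)) eq)
  (λ (Z , FZ , eq) → A △ Z , subst (λ W → F W ≡ true) (sym (△-involutive A Z)) FZ , eq)

width-twistF-cong : ∀ {n} {F G : Family n} A →
  (∀ s → Attains (λ Z → ∣ A △ Z ∣) F s ⇔ Attains (λ Z → ∣ A △ Z ∣) G s) →
  width (twistF F A) ≡ width (twistF G A)
width-twistF-cong {F = F} {G} A F⇔G = width-cong λ s →
  ⇔.trans (attains-twistF⇔ F A s) (⇔.trans (F⇔G s) (⇔.sym (attains-twistF⇔ G A s)))

attains-toggle⇔ : ∀ {n} (w : Subset n → ℕ) (F : Family n) (t : Subset n → Bool)
  (σ : Subset n → Subset n) →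
  (∀ Z → t Z ≡ true → F (σ Z) ≡ true × t (σ Z) ≡ false × w (σ Z) ≡ w Z) →
  ∀ s → Attains w F s ⇔ Attains w (λ Z → F Z xor t Z) s
attains-toggle⇔ w F t σ partner s = mk⇔ forth back
  where
  forth : Attains w F s → Attains w (λ Z → F Z xor t Z) s
  forth (Z , FZ , eq) with t Z in tZ
  ... | false = Z , trans (cong (F Z xor_) tZ) (trans (xor-identityʳ (F Z)) FZ) , eq
  ... | true with partner Z tZ
  ...   | FσZ , tσZ , wσZ = σ Z , cong₂ _xor_ FσZ tσZ , trans wσZ eq
  back : Attains w (λ Z → F Z xor t Z) s → Attains w F s
  back (Z , GZ , eq) with t Z in tZ
  ... | false = Z , trans (sym (xor-identityʳ (F Z))) GZ , eq
  ... | true with partner Z tZ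
  ...   | FσZ , _ , wσZ = σ Z , FσZ , trans wσZ eq

∣∷∷∣-comm : ∀ {n} x y (V : Subset n) → ∣ x ∷ y ∷ V ∣ ≡ ∣ y ∷ x ∷ V ∣
∣∷∷∣-comm false false V = refl
∣∷∷∣-comm false true  V = refl
∣∷∷∣-comm true  false V = refl
∣∷∷∣-comm true  true  V = refl

∣∷∣-cong : ∀ {n} x {U V : Subset n} → ∣ U ∣ ≡ ∣ V ∣ → ∣ x ∷ U ∣ ≡ ∣ x ∷ V ∣
∣∷∣-cong false eq = eq
∣∷∣-cong true  eq = cong suc eq

∣∷∣-cancel : ∀ {n} x {U V : Subset n} → ∣ x ∷ U ∣ ≡ ∣ x ∷ V ∣ → ∣ U ∣ ≡ ∣ V ∣
∣∷∣-cancel false eq = eq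
∣∷∣-cancel true  eq = suc-injective eq

∣lookup∷[]≔∣ : ∀ {n} (V : Subset n) i x → ∣ lookup V i ∷ V [ i ]≔ x ∣ ≡ ∣ x ∷ V ∣
∣lookup∷[]≔∣ (v ∷ V) zero x = ∣∷∷∣-comm v x V
∣lookup∷[]≔∣ (v ∷ V) (suc i) x = begin
  ∣ lookup V i ∷ v ∷ V [ i ]≔ x ∣
    ≡⟨ ∣∷∷∣-comm (lookup V i) v (V [ i ]≔ x) ⟩
  ∣ v ∷ lookup V i ∷ V [ i ]≔ x ∣
    ≡⟨ ∣∷∣-cong v {lookup V i ∷ V [ i ]≔ x} {x ∷ V} (∣lookup∷[]≔∣ V i x) ⟩
  ∣ v ∷ x ∷ V ∣
    ≡⟨ ∣∷∷∣-comm v x V ⟩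
  ∣ x ∷ v ∷ V ∣
    ∎
  where open ≡-Reasoning

∣swap∣ : ∀ {n} {i j : Fin n} → i ≢ j → (V : Subset n) →
  ∣ (V [ i ]≔ lookup V j) [ j ]≔ lookup V i ∣ ≡ ∣ V ∣
∣swap∣ {i = i} {j} i≢j V = ∣∷∣-cancel (lookup V j) {W [ j ]≔ lookup V i} {V} (begin
  ∣ lookup V j ∷ W [ j ]≔ lookup V i ∣ ≡⟨ cong (λ y → ∣ y ∷ W [ j ]≔ _ ∣) (sym Wj) ⟩
  ∣ lookup W j ∷ W [ j ]≔ lookup V i ∣ ≡⟨ ∣lookup∷[]≔∣ W j (lookup V i) ⟩
  ∣ lookup V i ∷ V [ i ]≔ lookup V j ∣ ≡⟨ ∣lookup∷[]≔∣ V i (lookup V j) ⟩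
  ∣ lookup V j ∷ V ∣                   ∎)
  where
  open ≡-Reasoning
  W : Subset _
  W = V [ i ]≔ lookup V j
  Wj : lookup W j ≡ lookup V j
  Wj = lookup∘update′ (i≢j ∘ sym) V (lookup V j)

△-[]≔ : ∀ {n} (A Z : Subset n) i x → A △ (Z [ i ]≔ x) ≡ (A △ Z) [ i ]≔ (lookup A i xor x)
△-[]≔ (_ ∷ A) (_ ∷ Z) zero x = refl
△-[]≔ (y ∷ A) (z ∷ Z) (suc i) x = cong ((y xor z) ∷_) (△-[]≔ A Z i x)

-- Resetting a and b in Z swaps the memberships of a and b in A △ Z.
∣△-reset∣ : ∀ {n} {a b : Fin n} → a ≢ b → (A Z : Subset n) (p q : Bool) →
  lookup A a xor p ≡ lookup A b xor lookup Z b →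
  lookup A b xor q ≡ lookup A a xor lookup Z a →
  ∣ A △ ((Z [ a ]≔ p) [ b ]≔ q) ∣ ≡ ∣ A △ Z ∣
∣△-reset∣ {a = a} {b} a≢b A Z p q eqa eqb = begin
  ∣ A △ ((Z [ a ]≔ p) [ b ]≔ q) ∣
    ≡⟨ cong ∣_∣ (△-[]≔ A _ b q) ⟩
  ∣ (A △ (Z [ a ]≔ p)) [ b ]≔ (lookup A b xor q) ∣
    ≡⟨ cong (λ V → ∣ V [ b ]≔ _ ∣) (△-[]≔ A Z a p) ⟩
  ∣ ((A △ Z) [ a ]≔ (lookup A a xor p)) [ b ]≔ (lookup A b xor q) ∣
    ≡⟨ cong₂ (λ x y → ∣ ((A △ Z) [ a ]≔ x) [ b ]≔ y ∣)
         (trans eqa (sym (lookup-△ b))) (trans eqb (sym (lookup-△ a))) ⟩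
  ∣ ((A △ Z) [ a ]≔ lookup (A △ Z) b) [ b ]≔ lookup (A △ Z) a ∣
    ≡⟨ ∣swap∣ a≢b (A △ Z) ⟩
  ∣ A △ Z ∣
    ∎
  where
  open ≡-Reasoning
  lookup-△ : ∀ i → lookup (A △ Z) i ≡ lookup A i xor lookup Z i
  lookup-△ i = lookup-zipWith _xor_ i A Z

∧-true⁻ : ∀ {x y} → x ∧ y ≡ true → x ≡ true × y ≡ true
∧-true⁻ {true} {true} refl = refl , refl

∧-falseˡ : ∀ {x y} → x ≡ false → x ∧ y ≡ false
∧-falseˡ refl = refl

xor-≡true : ∀ {x y} → y ≡ true → x xor y ≡ not x
xor-≡true {false} refl = refl
xor-≡true {true}  refl = refl

module _ {n} {a b : Fin n} (a≢b : a ≢ b) where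

  moveAtoB removeAB : Subset n → Subset n
  moveAtoB Z = (Z [ a ]≔ false) [ b ]≔ true
  removeAB Z = (Z [ a ]≔ false) [ b ]≔ false

  -- Definitionally, handleSlideF a b F Y = F Y xor slideToggle F Y; likewise for exchangeF.
  slideToggle exchangeToggle : Family n → Subset n → Bool
  slideToggle F Y = lookup Y a ∧ not (lookup Y b) ∧ F (moveAtoB Y)
  exchangeToggle F Y = lookup Y a ∧ lookup Y b ∧ F (removeAB Y)

  lookup-reset-a : ∀ (Z : Subset n) y → lookup ((Z [ a ]≔ false) [ b ]≔ y) a ≡ false
  lookup-reset-a Z y = trans (lookup∘update′ a≢b (Z [ a ]≔ false) y) (lookup∘update a Z false)

  handleSlideF-fixes : ∀ F Y → lookup Y a ≡ false → handleSlideF a b F Y ≡ F Y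
  handleSlideF-fixes F Y Ya = trans (cong (F Y xor_) (∧-falseˡ Ya)) (xor-identityʳ (F Y))

  exchangeF-fixes : ∀ F Y → lookup Y a ≡ false → exchangeF a b F Y ≡ F Y
  exchangeF-fixes F Y Ya = trans (cong (F Y xor_) (∧-falseˡ Ya)) (xor-identityʳ (F Y))

  width-twist-handleSlideF : ∀ F A → lookup A a ≡ lookup A b →
    width (twistF F A) ≡ width (twistF (handleSlideF a b F) A)
  width-twist-handleSlideF F A Aa≡Ab =
    width-twistF-cong A (attains-toggle⇔ _ F (slideToggle F) moveAtoB partner)
    where
    partner : ∀ Z → slideToggle F Z ≡ true →
      F (moveAtoB Z) ≡ true × slideToggle F (moveAtoB Z) ≡ false ×
      ∣ A △ moveAtoB Z ∣ ≡ ∣ A △ Z ∣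
    partner Z toggled with ∧-true⁻ toggled
    ... | Za , toggled′ with ∧-true⁻ toggled′
    ...   | ¬Zb , F-partner = F-partner , ∧-falseˡ (lookup-reset-a Z true) ,
      ∣△-reset∣ a≢b A Z false true
        (cong₂ _xor_ Aa≡Ab (sym (not-injective {y = false} ¬Zb)))
        (cong₂ _xor_ (sym Aa≡Ab) (sym Za))

  width-twist-exchangeF : ∀ F A → lookup A a ≢ lookup A b →
    width (twistF F A) ≡ width (twistF (exchangeF a b F) A)
  width-twist-exchangeF F A Aa≢Ab =
    width-twistF-cong A (attains-toggle⇔ _ F (exchangeToggle F) removeAB partner)
    where
    partner : ∀ Z → exchangeToggle F Z ≡ true →
      F (removeAB Z) ≡ true × exchangeToggle F (removeAB Z) ≡ false ×
      ∣ A △ removeAB Z ∣ ≡ ∣ A △ Z ∣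
    partner Z toggled with ∧-true⁻ toggled
    ... | Za , toggled′ with ∧-true⁻ toggled′
    ...   | Zb , F-partner = F-partner , ∧-falseˡ (lookup-reset-a Z false) ,
      ∣△-reset∣ a≢b A Z false false
        (trans (xor-identityʳ _) (trans (¬-not Aa≢Ab) (sym (xor-≡true Zb))))
        (trans (xor-identityʳ _) (trans (¬-not (Aa≢Ab ∘ sym)) (sym (xor-≡true Za))))

  -- Each operation only toggles sets containing a, and its partners avoid a.
  handleSlideF-exchangeF-comm : ∀ F →
    handleSlideF a b (exchangeF a b F) ≗ exchangeF a b (handleSlideF a b F)
  handleSlideF-exchangeF-comm F Y = begin
    (F Y xor E) xor (Ya ∧ not Yb ∧ exchangeF a b F (moveAtoB Y))
      ≡⟨ cong (λ x → (F Y xor E) xor (Ya ∧ not Yb ∧ x))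
              (exchangeF-fixes F (moveAtoB Y) (lookup-reset-a Y true)) ⟩
    (F Y xor E) xor S
      ≡⟨ xy∙z≈xz∙y (F Y) E S ⟩
    (F Y xor S) xor E
      ≡⟨ cong (λ x → (F Y xor S) xor (Ya ∧ Yb ∧ x))
              (sym (handleSlideF-fixes F (removeAB Y) (lookup-reset-a Y false))) ⟩
    (F Y xor S) xor (Ya ∧ Yb ∧ handleSlideF a b F (removeAB Y))
      ∎
    where
    open ≡-Reasoning
    open Algebra.Properties.CommutativeSemigroup
      (CommutativeRing.+-commutativeSemigroup xor-∧-commutativeRing) using (xy∙z≈xz∙y)
    Ya Yb S E : Bool
    Ya = lookup Y a
    Yb = lookup Y b
    S = slideToggle F Y
    E = exchangeToggle F Y

indicator : Bool → ℕ
indicator b = if b then 1 else 0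

occurrences : {X : Set} → ℕ → (X → ℕ) → List X → ℕ
occurrences k f xs = length (filter (λ x → f x ≟ k) xs)

occurrences-∷ : ∀ {X : Set} k (f : X → ℕ) x xs →
  occurrences k f (x ∷ xs) ≡ indicator (does (f x ≟ k)) ℕ.+ occurrences k f xs
occurrences-∷ k f x xs with does (f x ≟ k)
... | true  = refl
... | false = refl

occurrences-four-term : ∀ {X : Set} k (f₀ f₁ f₂ f₃ : X → ℕ) →
  (∀ x → (f₀ x ≡ f₂ x × f₁ x ≡ f₃ x) ⊎ (f₀ x ≡ f₃ x × f₁ x ≡ f₂ x)) → ∀ xs →
  occurrences k f₀ xs ℕ.+ occurrences k f₁ xs ≡ occurrences k f₂ xs ℕ.+ occurrences k f₃ xs
occurrences-four-term k f₀ f₁ f₂ f₃ same [] = refl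
occurrences-four-term k f₀ f₁ f₂ f₃ same (x ∷ xs) = begin
  occ f₀ (x ∷ xs) ℕ.+ occ f₁ (x ∷ xs)
    ≡⟨ cong₂ ℕ._+_ (occurrences-∷ k f₀ x xs) (occurrences-∷ k f₁ x xs) ⟩
  (hit (f₀ x) ℕ.+ occ f₀ xs) ℕ.+ (hit (f₁ x) ℕ.+ occ f₁ xs)
    ≡⟨ interchange (hit (f₀ x)) _ (hit (f₁ x)) _ ⟩
  (hit (f₀ x) ℕ.+ hit (f₁ x)) ℕ.+ (occ f₀ xs ℕ.+ occ f₁ xs)
    ≡⟨ cong₂ ℕ._+_ (same-hits (same x)) (occurrences-four-term k f₀ f₁ f₂ f₃ same xs) ⟩
  (hit (f₂ x) ℕ.+ hit (f₃ x)) ℕ.+ (occ f₂ xs ℕ.+ occ f₃ xs)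
    ≡⟨ interchange (hit (f₂ x)) _ (occ f₂ xs) _ ⟩
  (hit (f₂ x) ℕ.+ occ f₂ xs) ℕ.+ (hit (f₃ x) ℕ.+ occ f₃ xs)
    ≡⟨ sym (cong₂ ℕ._+_ (occurrences-∷ k f₂ x xs) (occurrences-∷ k f₃ x xs)) ⟩
  occ f₂ (x ∷ xs) ℕ.+ occ f₃ (x ∷ xs)
    ∎
  where
  open ≡-Reasoning
  occ : (_ → ℕ) → List _ → ℕ
  occ = occurrences k
  hit : ℕ → ℕ
  hit m = indicator (does (m ≟ k))
  same-hits : (f₀ x ≡ f₂ x × f₁ x ≡ f₃ x) ⊎ (f₀ x ≡ f₃ x × f₁ x ≡ f₂ x) →
    hit (f₀ x) ℕ.+ hit (f₁ x) ≡ hit (f₂ x) ℕ.+ hit (f₃ x)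
  same-hits (inj₁ (e₀₂ , e₁₃)) = cong₂ ℕ._+_ (cong hit e₀₂) (cong hit e₁₃)
  same-hits (inj₂ (e₀₃ , e₁₂)) =
    trans (cong₂ ℕ._+_ (cong hit e₀₃) (cong hit e₁₂)) (+-comm (hit (f₃ x)) _)

sum-difference-zero : ∀ p q r s → p ℕ.+ q ≡ r ℕ.+ s → (((+ p) + (+ q)) - (+ r)) - (+ s) ≡ + 0
sum-difference-zero p q r s eq = trans (cong (λ m → (+ m - + r) - + s) eq) (cancel (+ r) (+ s))
  where
  cancel : ∀ x y → ((x + y) - x) - y ≡ + 0
  cancel = solve-∀

theorem3p7 : (n : ℕ) (D : SetSystem n) (a b : Fin n) → a ≢ b →
    (k : ℕ) →
      (((+ twistPolyCoeff (feasible D) k)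
        + (+ twistPolyCoeff (handleSlideF a b (exchangeF a b (feasible D))) k))
        - (+ twistPolyCoeff (exchangeF a b (feasible D)) k))
        - (+ twistPolyCoeff (handleSlideF a b (feasible D)) k)
        ≡ + 0
theorem3p7 n D a b a≢b k =
  sum-difference-zero (c F) (c (slide (exchange F))) (c (exchange F)) (c (slide F))
  (occurrences-four-term k (ω F) (ω (slide (exchange F))) (ω (exchange F)) (ω (slide F))
    same-widths (allSubsets n))
  where
  F : Family n
  F = feasible D
  slide exchange : Family n → Family n
  slide = handleSlideF a b
  exchange = exchangeF a b
  ω : Family n → Subset n → ℕ
  ω G A = width (twistF G A)
  c : Family n → ℕ
  c G = twistPolyCoeff G k
  same-widths : ∀ A →
    (ω F A ≡ ω (exchange F) A × ω (slide (exchange F)) A ≡ ω (slide F) A) ⊎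
    (ω F A ≡ ω (slide F) A × ω (slide (exchange F)) A ≡ ω (exchange F) A)
  same-widths A with lookup A a ≟ᵇ lookup A b
  ... | yes Aa≡Ab = inj₂ (width-twist-handleSlideF a≢b F A Aa≡Ab ,
                          sym (width-twist-handleSlideF a≢b (exchange F) A Aa≡Ab))
  ... | no Aa≢Ab = inj₁ (width-twist-exchangeF a≢b F A Aa≢Ab ,
    trans (width-≗ (handleSlideF-exchangeF-comm a≢b F ∘ (A △_)))
          (sym (width-twist-exchangeF a≢b (slide F) A Aa≢Ab)))
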